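{- Let $(X,\Sigma,\nu)$ be a plain triple, let $\lambda,\mu>0$ and $r\in\mathcal B$. Then the queue-content process of the 0-automatic queue of type $(X,\Sigma,\nu,r,\lambda,\mu)$ is irreducible on $L(X,\Sigma)$.
   Context: Let $X$ be a monoid with product $\ast$ and unit $1_X$. $\Sigma^*$ denotes the free monoid of words over a finite set $\Sigma$, with empty word $1_{\Sigma^*}$. A plain monoid is a free product $X=S^*\star\mathbb F(T)\star X_1\star\cdots\star X_k$, where $S,T$ are finite sets, $S^*$ is the free monoid on $S$, $\mathbb F(T)$ is the free group on $T$ and $X_1,\dots,X_k$ are finite monoids; its natural generating set is $\Sigma=S\sqcup T\sqcup T^{ -1}\sqcup(X_1\setminus\{1_{X_1}\})\sqcup\cdots\sqcup(X_k\setminus\{1_{X_k}\})$. Put $L(X,\Sigma)=\{u_1\cdots u_k\in\Sigma^*:\ u_i\ast u_{i+1}\notin\Sigma\cup\{1_X\}\text{ for all }i<k\}$ (evaluation gives a bijection $L(X,\Sigma)\to X$). For $a\in\Sigma$ let $\mathrm{Next}(a)=\{b\in\Sigma: a\ast b\notin\Sigma\cup\{1_X\}\}$ (which equals $\{b\in\Sigma: b\ast a\notin\Sigma\cup\{1_X\}\}$). For $x\in\mathbb R^\Sigma$ and $E\subset\Sigma$, $x(E)=\sum_{a\in E}x(a)$. Let $\mathcal B=\{x\in\mathbb R^\Sigma: x(a)>0\ \forall a,\ \sum_a x(a)=1\}$ and $\bar{\mathcal B}$ the analogous set with $x(a)\ge 0$. A plain triple $(X,\Sigma,\nu)$ consists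 of an infinite plain monoid $X$ not isomorphic to $\mathbb Z$ nor to $\mathbb Z/2\mathbb Z\star\mathbb Z/2\mathbb Z$, its natural generating set $\Sigma$, and a probability measure $\nu$ on $\Sigma$ whose support generates $X$. The 0-automatic queue of type $(X,\Sigma,\nu,r,\lambda,\mu)$ ($r\in\bar{\mathcal B}$, $\lambda,\mu>0$) is the continuous-time Markov jump process (queue-content process) on $L(X,\Sigma)$ with generator $Q_r$ defined as follows. A word $u=u_n\cdots u_1$ represents the buffer, $u_1$ being the front customer (in service) and $u_n$ the back customer. For $n\ge 1$ and $v\ne u$, $Q_r(u,v)$ is the sum of the following contributions to the target $v$: for each $b\in\mathrm{Next}(u_n)$, $\lambda\nu(b)$ to $v=bu_n\cdots u_1$; for each $b\in\Sigma$ with $b\ast u_n=c\in\Sigma$, $c\ne u_n$, $\lambda\nu(b)$ to $v=cu_{n-1}\cdots u_1$; for each $b\in\Sigma$ with $b\ast u_n=1_X$, $\lambda\nu(b)$ to $v=u_{n-1}\cdots u_1$; and $\mu$ (service) to $v=u_n\cdots u_2$ (which is $1_{\Sigma^*}$ if $n=1$). From the empty word, $Q_r(1_{\Sigma^*},a)=\lambda\nu(a)\,r(\mathrm{Next}(a))$ for $a\in\Sigma$. All other off-diagonal entries are $0$, and diagonal entries make row sums zero.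
   Formalization: The rates λ and μ, the probability measure ν and the vector $r\in\mathcal B$ take rational values instead of real ones. -}

module Defs where

open import Data.Nat using (ℕ)
open import Data.Fin using (Fin; zero; suc)
open import Data.Fin.Properties using () renaming (_≟_ to _≟F_)
open import Data.Maybe using (Maybe; just; nothing)
open import Data.Bool using (Bool; true; false; T; _∧_; not; if_then_else_)
open import Data.Bool.Properties using (T-irrelevant)
open import Data.List using (List; []; _∷_; _++_; map; concatMap; foldr; allFin; filter)
open import Data.List.Properties using (≡-dec)
open import Data.List.Membership.Propositional using (_∉_)
open import Data.List.Relation.Unary.All using (All)
open import Data.Product using (Σ; _×_; _,_; proj₁; ∃)
open import Data.Unit using (⊤; tt)
open import Data.Empty using (⊥)
open import Relation.Nullary using (¬_; Dec; yes; no)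
open import Relation.Nullary.Decidable using (⌊_⌋)
open import Relation.Binary.PropositionalEquality using (_≡_; refl; _≢_; cong)
open import Data.Rational using (ℚ; 0ℚ; 1ℚ; _+_; _*_; _<_; _≤_)

-- Finite monoids.  A finite monoid is presented (up to isomorphism) with
-- carrier  Maybe (Fin m) : 'nothing' is the unit, 'just x' (x : Fin m)
-- are the m non-unit elements.

record FinMonoid : Set where
  field
    m     : ℕ
    op    : Maybe (Fin m) → Maybe (Fin m) → Maybe (Fin m)
    identityˡ : ∀ x → op nothing x ≡ x
    identityʳ : ∀ x → op x nothing ≡ x
    assoc : ∀ x y z → op (op x y) z ≡ op x (op y z)
open FinMonoid public

-- Data of a plain monoid  S* ⋆ F(T) ⋆ X_1 ⋆ ... ⋆ X_k
-- with S = Fin s, T = Fin t.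

record PlainData : Set where
  field
    s t k : ℕ
    X     : Fin k → FinMonoid
open PlainData public

data Letter (P : PlainData) : Set where
  sL : Fin (s P) → Letter P
  tL : Fin (t P) → Letter P
  tI : Fin (t P) → Letter P                       -- a⁻¹ ∈ T⁻¹
  xL : (i : Fin (k P)) → Fin (m (X P i)) → Letter P

module _ {P : PlainData} where

  _≟L_ : (a b : Letter P) → Dec (a ≡ b)
  sL a ≟L sL b with a ≟F b
  ... | yes refl = yes refl
  ... | no ne = no λ { refl → ne refl }
  tL a ≟L tL b with a ≟F b
  ... | yes refl = yes refl
  ... | no ne = no λ { refl → ne refl }
  tI a ≟L tI b with a ≟F b
  ... | yes refl = yes refl
  ... | no ne = no λ { refl → ne refl }
  xL i x ≟L xL j y with i ≟F j
  ... | no ne = no λ { refl → ne refl }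
  ... | yes refl with x ≟F y
  ...   | yes refl = yes refl
  ...   | no ne = no λ { refl → ne refl }
  sL _ ≟L tL _ = no λ ()
  sL _ ≟L tI _ = no λ ()
  sL _ ≟L xL _ _ = no λ ()
  tL _ ≟L sL _ = no λ ()
  tL _ ≟L tI _ = no λ ()
  tL _ ≟L xL _ _ = no λ ()
  tI _ ≟L sL _ = no λ ()
  tI _ ≟L tL _ = no λ ()
  tI _ ≟L xL _ _ = no λ ()
  xL _ _ ≟L sL _ = no λ ()
  xL _ _ ≟L tL _ = no λ ()
  xL _ _ ≟L tI _ = no λ ()

  _≟W_ : (u v : List (Letter P)) → Dec (u ≡ v)
  _≟W_ = ≡-dec _≟L_

-- Result of the product a ∗ b of two generators in X:
-- the unit 1_X, a generator c ∈ Σ, or an element outside Σ ∪ {1_X}.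
data Prod (P : PlainData) : Set where
  one    : Prod P
  letter : Letter P → Prod P
  other  : Prod P

isOther : ∀ {P} → Prod P → Bool
isOther other = true
isOther _     = false

mulL : ∀ {P} → Letter P → Letter P → Prod P
mulL (tL a) (tI b) = if ⌊ a ≟F b ⌋ then one else other
mulL (tI a) (tL b) = if ⌊ a ≟F b ⌋ then one else other
mulL {P} (xL i x) (xL j y) with i ≟F j
... | no _ = other
... | yes refl with op (X P i) (just x) (just y)
...   | nothing = one
...   | just z  = letter (xL i z)
mulL _ _ = other

inNext : ∀ {P} → Letter P → Letter P → Bool
inNext a b = isOther (mulL a b)

-- The language L(X,Σ) of normal forms.  Words are lists, written
-- left-to-right:  the list  x₁ ∷ x₂ ∷ … ∷ xₙ  is the word x₁x₂⋯xₙ.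
isNormal : ∀ {P} → List (Letter P) → Bool
isNormal [] = true
isNormal (x ∷ []) = true
isNormal (x ∷ y ∷ w) = isOther (mulL x y) ∧ isNormal (y ∷ w)

Normal : ∀ {P} → List (Letter P) → Set
Normal w = T (isNormal w)

-- Elements of X = normal words (evaluation L(X,Σ) → X is a bijection).
NW : PlainData → Set
NW P = Σ (List (Letter P)) Normal

lm : ∀ {P} → Letter P → List (Letter P) → List (Letter P)
lm b [] = b ∷ []
lm b (x ∷ w) with mulL b x
... | one = w
... | letter c = c ∷ w
... | other = b ∷ x ∷ w

eval : ∀ {P} → List (Letter P) → List (Letter P)
eval = foldr lm []

private
  T-∧ : ∀ {a b} → T (a ∧ b) → T a × T b
  T-∧ {true} {true} p = tt , tt

  ∧-T : ∀ {a b} → T a → T b → T (a ∧ b)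
  ∧-T {true} {true} _ _ = tt

  tailN : ∀ {P} (x : Letter P) w → Normal (x ∷ w) → Normal w
  tailN x [] _ = tt
  tailN x (y ∷ w) n = Data.Product.proj₂ (T-∧ {isOther (mulL x y)} n)

  keyXX : ∀ {P} (i : Fin (k P)) (z x : Fin (m (X P i))) (y : Letter P) →
          T (isOther (mulL (xL i x) y)) → T (isOther (mulL (xL i z) y))
  keyXX i z x (sL _) _ = tt
  keyXX i z x (tL _) _ = tt
  keyXX i z x (tI _) _ = tt
  keyXX {P} i z x (xL j y) h with i ≟F j
  ... | no _ = tt
  ... | yes refl with op (X P i) (just x) (just y) | h
  ...   | nothing | ()
  ...   | just _ | ()

  key : ∀ {P} (b x c y : Letter P) → mulL b x ≡ letter c →
        T (isOther (mulL x y)) → T (isOther (mulL c y))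
  key (sL _) (sL _) c y ()
  key (sL _) (tL _) c y ()
  key (sL _) (tI _) c y ()
  key (sL _) (xL _ _) c y ()
  key (tL _) (sL _) c y ()
  key (tL a) (tL b) c y ()
  key (tL a) (tI b) c y e with a ≟F b
  key (tL a) (tI b) c y () | yes _
  key (tL a) (tI b) c y () | no _
  key (tL _) (xL _ _) c y ()
  key (tI _) (sL _) c y ()
  key (tI a) (tL b) c y e with a ≟F b
  key (tI a) (tL b) c y () | yes _
  key (tI a) (tL b) c y () | no _
  key (tI _) (tI _) c y ()
  key (tI _) (xL _ _) c y ()
  key (xL _ _) (sL _) c y ()
  key (xL _ _) (tL _) c y ()
  key (xL _ _) (tI _) c y ()
  key {P} (xL i b) (xL j x) c y e with i ≟F j
  key {P} (xL i b) (xL j x) c y () | no _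
  ... | yes refl with op (X P i) (just b) (just x)
  key {P} (xL i b) (xL i x) c y () | yes refl | nothing
  key {P} (xL i b) (xL i x) .(xL i z) y refl | yes refl | just z =
    keyXX i z x y

lm-normal : ∀ {P} (b : Letter P) (w : List (Letter P)) →
            Normal w → Normal (lm b w)
lm-normal b [] _ = tt
lm-normal b (x ∷ w) n with mulL b x in eq
... | one = tailN x w n
... | other = ∧-T {isOther (mulL b x)} (subst' eq) n
  where
    subst' : mulL b x ≡ other → T (isOther (mulL b x))
    subst' e rewrite e = tt
lm-normal b (x ∷ []) n | letter c = tt
lm-normal b (x ∷ y ∷ w) n | letter c =
  let (h , n') = T-∧ {isOther (mulL x y)} n in
  ∧-T {isOther (mulL c y)} (key b x c y eq h) n'

eval-normal : ∀ {P} (w : List (Letter P)) → Normal (eval w)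
eval-normal [] = tt
eval-normal (a ∷ w) = lm-normal a (eval w) (eval-normal w)

mulW : ∀ {P} → List (Letter P) → List (Letter P) → List (Letter P)
mulW u v = foldr lm v u

mulW-normal : ∀ {P} (u v : List (Letter P)) → Normal v → Normal (mulW u v)
mulW-normal [] v n = n
mulW-normal (a ∷ u) v n = lm-normal a (mulW u v) (mulW-normal u v n)

_·_ : ∀ {P} → NW P → NW P → NW P
(u , _) · (v , nv) = mulW u v , mulW-normal u v nv

ε : ∀ {P} → NW P
ε = [] , tt

record _≅_ (P Q : PlainData) : Set where
  field
    to    : NW P → NW Q
    from  : NW Q → NW P
    from∘to : ∀ x → proj₁ (from (to x)) ≡ proj₁ x
    to∘from : ∀ y → proj₁ (to (from y)) ≡ proj₁ y
    to-hom  : ∀ x y → proj₁ (to (x · y)) ≡ proj₁ (to x · to y)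
    to-unit : proj₁ (to ε) ≡ []

Infinite : PlainData → Set
Infinite P = ∀ (ws : List (List (Letter P))) → ∃ λ w → Normal w × w ∉ ws

ℤ-plain : PlainData
ℤ-plain = record { s = 0 ; t = 1 ; k = 0 ; X = λ () }

Z2-op : Maybe (Fin 1) → Maybe (Fin 1) → Maybe (Fin 1)
Z2-op nothing y = y
Z2-op (just x) nothing = just x
Z2-op (just _) (just _) = nothing

Z2 : FinMonoid
Z2 = record
  { m = 1 ; op = Z2-op
  ; identityˡ = λ _ → refl
  ; identityʳ = λ { nothing → refl ; (just _) → refl }
  ; assoc = λ { nothing y z → refl
              ; (just zero) nothing z → refl
              ; (just zero) (just zero) nothing → refl
              ; (just zero) (just zero) (just zero) → refl } }

Z2⋆Z2-plain : PlainData
Z2⋆Z2-plain = record { s = 0 ; t = 0 ; k = 2 ; X = λ _ → Z2 }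

allLetters : (P : PlainData) → List (Letter P)
allLetters P = map sL (allFin (s P)) ++ map tL (allFin (t P)) ++ map tI (allFin (t P))
  ++ concatMap (λ i → map (xL i) (allFin (m (X P i)))) (allFin (k P))

sumℚ : List ℚ → ℚ
sumℚ = foldr _+_ 0ℚ

massNext : ∀ {P} → (Letter P → ℚ) → Letter P → ℚ
massNext {P} x a = sumℚ (map (λ b → if inNext a b then x b else 0ℚ) (allLetters P))

IsProb : ∀ {P} → (Letter P → ℚ) → Set
IsProb {P} x = (∀ a → 0ℚ ≤ x a) × sumℚ (map x (allLetters P)) ≡ 1ℚ

InB : ∀ {P} → (Letter P → ℚ) → Set
InB {P} x = (∀ a → 0ℚ < x a) × sumℚ (map x (allLetters P)) ≡ 1ℚ

SupportGenerates : ∀ {P} → (Letter P → ℚ) → Set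
SupportGenerates {P} ν = ∀ (w : List (Letter P)) → Normal w →
  ∃ λ (as : List (Letter P)) → All (λ a → 0ℚ < ν a) as × eval as ≡ w

record PlainTriple (P : PlainData) (ν : Letter P → ℚ) : Set where
  field
    infinite   : Infinite P
    not-ℤ      : ¬ (P ≅ ℤ-plain)
    not-Z2⋆Z2  : ¬ (P ≅ Z2⋆Z2-plain)
    prob       : IsProb ν
    generates  : SupportGenerates ν

-- The generator Q_r of the 0-automatic queue.
-- A buffer u = uₙ ⋯ u₁ is the list  uₙ ∷ … ∷ u₁ ∷ []  (head = back
-- customer uₙ, last element = front customer u₁ in service).

dropLast : ∀ {A : Set} → List A → List A
dropLast [] = []
dropLast (x ∷ []) = []
dropLast (x ∷ y ∷ w) = x ∷ dropLast (y ∷ w)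

ifEq : ∀ {P} → List (Letter P) → List (Letter P) → ℚ → ℚ
ifEq v w q with v ≟W w
... | yes _ = q
... | no _  = 0ℚ

module _ {P : PlainData} (ν : Letter P → ℚ) (r : Letter P → ℚ) (λ' μ : ℚ) where

  arrival : Letter P → List (Letter P) → Letter P → List (Letter P) → ℚ
  arrival x w b v =
    (if inNext x b then ifEq v (b ∷ x ∷ w) (λ' * ν b) else 0ℚ)
    + rest (mulL b x)
    where
      rest : Prod P → ℚ
      rest one = ifEq v w (λ' * ν b)
      rest (letter c) with c ≟L x
      ... | yes _ = 0ℚ
      ... | no _  = ifEq v (c ∷ w) (λ' * ν b)
      rest other = 0ℚ

  -- Q_r(u,v) for u ≠ v
  Q : List (Letter P) → List (Letter P) → ℚ
  Q [] v = sumℚ (map (λ a → ifEq v (a ∷ []) (λ' * ν a * massNext r a)) (allLetters P))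
  Q (x ∷ w) v = sumℚ (map (λ b → arrival x w b v) (allLetters P))
                + ifEq v (dropLast (x ∷ w)) μ

  data Reach : List (Letter P) → List (Letter P) → Set where
    here : ∀ {u} → Reach u u
    step : ∀ {u v w} → u ≢ v → Normal v → 0ℚ < Q u v → Reach v w → Reach u w

  Irreducible : Set
  Irreducible = ∀ u v → Normal u → Normal v → Reach u v

{-# OPTIONS --safe #-}
module Submission where

open import Defs
open import Data.Rational using (ℚ; 0ℚ; _<_; _≤_; _+_; _*_; positive; nonNegative)
import Data.Rational.Properties as ℚ
open import Data.Nat using (suc)
open import Data.Nat.Properties using (suc-injective)
open import Data.Fin using (Fin)
open import Data.Fin.Properties using () renaming (_≟_ to _≟F_)
open import Data.Bool using (true; false; T; if_then_else_)
open import Data.Bool.Properties using (T-∧)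
open import Data.List using (List; []; _∷_; [_]; map; length; allFin)
open import Data.List.Membership.Propositional using (_∈_)
open import Data.List.Membership.Propositional.Properties
  using (∈-map⁺; ∈-++⁺ˡ; ∈-++⁺ʳ; ∈-concatMap⁺; ∈-allFin)
open import Data.List.Relation.Unary.Any using (here; there)
import Data.List.Relation.Unary.Any as Any
open import Data.List.Relation.Unary.All using (All; []; _∷_)
open import Data.Product using (_,_; proj₁; ∃)
open import Data.Unit using (tt)
open import Data.Maybe using (just; nothing)
open import Data.Empty using (⊥-elim)
open import Function using (_∘_; case_of_)
open import Function.Bundles using (Equivalence)
open import Relation.Nullary using (¬_; Dec; yes; no)
open import Relation.Nullary.Decidable using (⌊_⌋)
open import Relation.Binary.PropositionalEquality
  using (_≡_; _≢_; refl; sym; trans; subst; cong)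

-- Services occur at rate μ > 0 and remove the front customer, so every buffer
-- reaches the empty one.  An arrival of a letter b with ν(b) > 0 turns the
-- buffer u into the normal form of b ∗ u at positive rate; from the empty
-- buffer that rate is λ ν(b) r(Next(b)), positive because Next(b) is nonempty
-- once X is infinite.  As supp ν generates X, arrivals then build any normal
-- word from the empty buffer.

nonNeg+nonNeg : ∀ {p q} → 0ℚ ≤ p → 0ℚ ≤ q → 0ℚ ≤ p + q
nonNeg+nonNeg = ℚ.+-mono-≤

pos+nonNeg : ∀ {p q} → 0ℚ < p → 0ℚ ≤ q → 0ℚ < p + q
pos+nonNeg = ℚ.+-mono-<-≤

nonNeg+pos : ∀ {p q} → 0ℚ ≤ p → 0ℚ < q → 0ℚ < p + q
nonNeg+pos = ℚ.+-mono-≤-<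

nonNeg*nonNeg : ∀ {p q} → 0ℚ ≤ p → 0ℚ ≤ q → 0ℚ ≤ p * q
nonNeg*nonNeg {p} {q} 0≤p 0≤q = ℚ.nonNegative⁻¹ _
  {{ℚ.nonNeg*nonNeg⇒nonNeg p {{nonNegative 0≤p}} q {{nonNegative 0≤q}}}}

pos*pos : ∀ {p q} → 0ℚ < p → 0ℚ < q → 0ℚ < p * q
pos*pos {p} {q} 0<p 0<q = ℚ.positive⁻¹ _
  {{ℚ.pos*pos⇒pos p {{positive 0<p}} q {{positive 0<q}}}}

if-nonNeg : ∀ c {p} → 0ℚ ≤ p → 0ℚ ≤ (if c then p else 0ℚ)
if-nonNeg true  0≤p = 0≤p
if-nonNeg false _   = ℚ.≤-refl

ifEq-nonNeg : ∀ {P} (v w : List (Letter P)) {q} → 0ℚ ≤ q → 0ℚ ≤ ifEq v w q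
ifEq-nonNeg v w 0≤q with v ≟W w
... | yes _ = 0≤q
... | no _  = ℚ.≤-refl

ifEq-diagonal-pos : ∀ {P} (v : List (Letter P)) {q} → 0ℚ < q → 0ℚ < ifEq v v q
ifEq-diagonal-pos v 0<q with v ≟W v
... | yes _  = 0<q
... | no v≢v = ⊥-elim (v≢v refl)

sumℚ-nonNeg : ∀ {A : Set} (f : A → ℚ) (xs : List A) →
              (∀ x → 0ℚ ≤ f x) → 0ℚ ≤ sumℚ (map f xs)
sumℚ-nonNeg f []       _   = ℚ.≤-refl
sumℚ-nonNeg f (x ∷ xs) f≥0 = nonNeg+nonNeg (f≥0 x) (sumℚ-nonNeg f xs f≥0)

sumℚ-pos : ∀ {A : Set} (f : A → ℚ) {xs : List A} {y : A} →
           (∀ x → 0ℚ ≤ f x) → y ∈ xs → 0ℚ < f y → 0ℚ < sumℚ (map f xs)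
sumℚ-pos f {_ ∷ xs} f≥0 (here refl) 0<fy = pos+nonNeg 0<fy (sumℚ-nonNeg f xs f≥0)
sumℚ-pos f {x ∷ _}  f≥0 (there y∈xs) 0<fy = nonNeg+pos (f≥0 x) (sumℚ-pos f f≥0 y∈xs 0<fy)

∈-allLetters : ∀ {P} (a : Letter P) → a ∈ allLetters P
∈-allLetters (sL i) = ∈-++⁺ˡ (∈-map⁺ sL (∈-allFin i))
∈-allLetters {P} (tL i) = ∈-++⁺ʳ (map sL (allFin (s P))) (∈-++⁺ˡ (∈-map⁺ tL (∈-allFin i)))
∈-allLetters {P} (tI i) = ∈-++⁺ʳ (map sL (allFin (s P))) (∈-++⁺ʳ (map tL (allFin (t P)))
  (∈-++⁺ˡ (∈-map⁺ tI (∈-allFin i))))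
∈-allLetters {P} (xL i y) = ∈-++⁺ʳ (map sL (allFin (s P))) (∈-++⁺ʳ (map tL (allFin (t P)))
  (∈-++⁺ʳ (map tI (allFin (t P)))
    (∈-concatMap⁺ (λ j → map (xL j) (allFin (m (X P j))))
      (Any.map (λ { refl → ∈-map⁺ (xL i) (∈-allFin y) }) (∈-allFin i)))))

InFactor : ∀ {P} → Fin (k P) → Letter P → Set
InFactor {P} i c = ∃ λ (z : Fin (m (X P i))) → c ≡ xL i z

inFactor? : ∀ {P} (i : Fin (k P)) (c : Letter P) → Dec (InFactor i c)
inFactor? i (sL _) = no λ { (_ , ()) }
inFactor? i (tL _) = no λ { (_ , ()) }
inFactor? i (tI _) = no λ { (_ , ()) }
inFactor? i (xL j z) with i ≟F j
... | yes refl = yes (z , refl)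
... | no i≢j   = no λ { (_ , refl) → i≢j refl }

mulL-xL-other : ∀ {P} {i : Fin (k P)} (y : Fin (m (X P i))) (c : Letter P) →
                ¬ InFactor i c → mulL (xL i y) c ≡ other
mulL-xL-other y (sL _) _ = refl
mulL-xL-other y (tL _) _ = refl
mulL-xL-other y (tI _) _ = refl
mulL-xL-other {i = i} y (xL j z) ∉i with i ≟F j
... | yes refl = ⊥-elim (∉i (z , refl))
... | no _     = refl

mulL-sameFactor-≢other : ∀ {P} (i : Fin (k P)) (y z : Fin (m (X P i))) →
                         mulL {P} (xL i y) (xL i z) ≢ other
mulL-sameFactor-≢other {P} i y z yz≡other with i ≟F i
... | no i≢i = i≢i refl
... | yes refl with op (X P i) (just y) (just z)
mulL-sameFactor-≢other {P} i y z () | yes refl | nothing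
mulL-sameFactor-≢other {P} i y z () | yes refl | just _

⌊≟F⌋-sym : ∀ {n} (a c : Fin n) → ⌊ a ≟F c ⌋ ≡ ⌊ c ≟F a ⌋
⌊≟F⌋-sym a c with a ≟F c | c ≟F a
... | yes _   | yes _   = refl
... | no _    | no _    = refl
... | yes a≡c | no c≢a  = ⊥-elim (c≢a (sym a≡c))
... | no a≢c  | yes c≡a = ⊥-elim (a≢c (sym c≡a))

mulL-other-sym : ∀ {P} (a b : Letter P) → mulL a b ≡ other → mulL b a ≡ other
mulL-other-sym (tL a) (tI c) ab≡other rewrite ⌊≟F⌋-sym c a = ab≡other
mulL-other-sym (tI a) (tL c) ab≡other rewrite ⌊≟F⌋-sym c a = ab≡other
mulL-other-sym (xL i y) (xL j z) ab≡other = case i ≟F j of λ where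
  (yes refl) → ⊥-elim (mulL-sameFactor-≢other i y z ab≡other)
  (no i≢j)   → mulL-xL-other z (xL i y) λ { (_ , refl) → i≢j refl }
mulL-other-sym (sL _) (sL _) _ = refl
mulL-other-sym (sL _) (tL _) _ = refl
mulL-other-sym (sL _) (tI _) _ = refl
mulL-other-sym (sL _) (xL _ _) _ = refl
mulL-other-sym (tL _) (sL _) _ = refl
mulL-other-sym (tL _) (tL _) _ = refl
mulL-other-sym (tL _) (xL _ _) _ = refl
mulL-other-sym (tI _) (sL _) _ = refl
mulL-other-sym (tI _) (tI _) _ = refl
mulL-other-sym (tI _) (xL _ _) _ = refl
mulL-other-sym (xL _ _) (sL _) _ = refl
mulL-other-sym (xL _ _) (tL _) _ = refl
mulL-other-sym (xL _ _) (tI _) _ = refl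

NonemptyNext : PlainData → Set
NonemptyNext P = (a : Letter P) → ∃ λ b → mulL a b ≡ other

-- An infinite X has a normal word a a' ⋯ of length ≥ 2; for a letter of X_i,
-- whichever of a, a' lies outside X_i is in its Next set.
infinite⇒nonemptyNext : ∀ {P} → Infinite P → NonemptyNext P
infinite⇒nonemptyNext _ (sL q) = sL q , refl
infinite⇒nonemptyNext _ (tL q) = tL q , refl
infinite⇒nonemptyNext _ (tI q) = tI q , refl
infinite⇒nonemptyNext {P} inf (xL i y) with inf ([] ∷ map [_] (allLetters P))
... | [] , _ , ∉ = ⊥-elim (∉ (here refl))
... | a ∷ [] , _ , ∉ = ⊥-elim (∉ (there (∈-map⁺ [_] (∈-allLetters a))))
... | a ∷ a' ∷ _ , normal , _ with inFactor? i a
...   | no a∉i = a , mulL-xL-other y a a∉i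
...   | yes (z , refl) = a' , mulL-xL-other y a' λ { (z' , refl) →
          mulL-sameFactor-≢other i z z' (isOther⇒≡other (Equivalence.to T-∧ normal .proj₁)) }
  where
    isOther⇒≡other : ∀ {p : Prod P} → T (isOther p) → p ≡ other
    isOther⇒≡other {other} _ = refl

dropLast-normal : ∀ {P} (x : Letter P) w → Normal (x ∷ w) → Normal (dropLast (x ∷ w))
dropLast-normal x []          _      = tt
dropLast-normal x (_ ∷ [])    _      = tt
dropLast-normal x (y ∷ z ∷ w) normal =
  let xy , yzw = Equivalence.to T-∧ normal
  in  Equivalence.from T-∧ (xy , dropLast-normal y (z ∷ w) yzw)

length-dropLast : ∀ {A : Set} (x : A) w → length (dropLast (x ∷ w)) ≡ length w
length-dropLast x []      = refl
length-dropLast x (y ∷ w) = cong suc (length-dropLast y w)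

module Queue {P : PlainData} (ν r : Letter P → ℚ) (λ' μ : ℚ)
  (ν≥0 : ∀ a → 0ℚ ≤ ν a) (r>0 : ∀ a → 0ℚ < r a) (nonemptyNext : NonemptyNext P)
  (λ'>0 : 0ℚ < λ') (μ>0 : 0ℚ < μ) where

  λν≥0 : ∀ b → 0ℚ ≤ λ' * ν b
  λν≥0 b = nonNeg*nonNeg (ℚ.<⇒≤ λ'>0) (ν≥0 b)

  join-nonNeg : ∀ x w b v → 0ℚ ≤ (if inNext x b then ifEq v (b ∷ x ∷ w) (λ' * ν b) else 0ℚ)
  join-nonNeg x w b v = if-nonNeg (inNext x b) (ifEq-nonNeg v (b ∷ x ∷ w) (λν≥0 b))

  arrival-nonNeg : ∀ x w b v → 0ℚ ≤ arrival ν r λ' μ x w b v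
  arrival-nonNeg x w b v with mulL b x
  ... | one   = nonNeg+nonNeg (join-nonNeg x w b v) (ifEq-nonNeg v w (λν≥0 b))
  ... | other = nonNeg+nonNeg (join-nonNeg x w b v) ℚ.≤-refl
  ... | letter c with c ≟L x
  ...   | yes _ = nonNeg+nonNeg (join-nonNeg x w b v) ℚ.≤-refl
  ...   | no _  = nonNeg+nonNeg (join-nonNeg x w b v) (ifEq-nonNeg v (c ∷ w) (λν≥0 b))

  arrival-pos : ∀ x w b → 0ℚ < ν b → lm b (x ∷ w) ≢ x ∷ w →
                0ℚ < arrival ν r λ' μ x w b (lm b (x ∷ w))
  arrival-pos x w b ν>0 moves with mulL b x in bx
  ... | one = nonNeg+pos (join-nonNeg x w b w)
                         (ifEq-diagonal-pos w (pos*pos λ'>0 ν>0))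
  ... | other rewrite mulL-other-sym b x bx =
          pos+nonNeg (ifEq-diagonal-pos (b ∷ x ∷ w) (pos*pos λ'>0 ν>0)) ℚ.≤-refl
  ... | letter c with c ≟L x
  ...   | yes refl = ⊥-elim (moves refl)
  ...   | no _     = nonNeg+pos (join-nonNeg x w b (c ∷ w))
                                (ifEq-diagonal-pos (c ∷ w) (pos*pos λ'>0 ν>0))

  massNext-pos : ∀ a → 0ℚ < massNext r a
  massNext-pos a with nonemptyNext a
  ... | b , ab≡other = sumℚ-pos _ (λ c → if-nonNeg (inNext a c) (ℚ.<⇒≤ (r>0 c)))
                         (∈-allLetters b) (inNext-pos ab≡other)
    where
      inNext-pos : ∀ {p : Prod P} → p ≡ other → 0ℚ < (if isOther p then r b else 0ℚ)
      inNext-pos refl = r>0 b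

  Q-arrival-pos : ∀ u b → 0ℚ < ν b → lm b u ≢ u → 0ℚ < Q ν r λ' μ u (lm b u)
  Q-arrival-pos [] b ν>0 _ = sumℚ-pos _
    (λ a → ifEq-nonNeg (b ∷ []) (a ∷ []) (nonNeg*nonNeg (λν≥0 a) (ℚ.<⇒≤ (massNext-pos a))))
    (∈-allLetters b) (ifEq-diagonal-pos (b ∷ []) (pos*pos (pos*pos λ'>0 ν>0) (massNext-pos b)))
  Q-arrival-pos (x ∷ w) b ν>0 moves = pos+nonNeg
    (sumℚ-pos _ (λ b' → arrival-nonNeg x w b' _) (∈-allLetters b) (arrival-pos x w b ν>0 moves))
    (ifEq-nonNeg (lm b (x ∷ w)) (dropLast (x ∷ w)) (ℚ.<⇒≤ μ>0))

  Q-service-pos : ∀ x w → 0ℚ < Q ν r λ' μ (x ∷ w) (dropLast (x ∷ w))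
  Q-service-pos x w = nonNeg+pos (sumℚ-nonNeg _ (allLetters P) (λ b → arrival-nonNeg x w b _))
                                 (ifEq-diagonal-pos (dropLast (x ∷ w)) μ>0)

  Reach-trans : ∀ {u v w} → Reach ν r λ' μ u v → Reach ν r λ' μ v w → Reach ν r λ' μ u w
  Reach-trans here                    v↝w = v↝w
  Reach-trans (step u≢v nv Q>0 v'↝v) v↝w = step u≢v nv Q>0 (Reach-trans v'↝v v↝w)

  Reach-edge : ∀ {u v} → Normal v → (u ≢ v → 0ℚ < Q ν r λ' μ u v) → Reach ν r λ' μ u v
  Reach-edge {u} {v} nv Q>0 with u ≟W v
  ... | yes refl = here
  ... | no u≢v   = step u≢v nv (Q>0 u≢v) here

  Reach-mulW : ∀ as u → Normal u → All (λ a → 0ℚ < ν a) as → Reach ν r λ' μ u (mulW as u)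
  Reach-mulW []       u nu []            = here
  Reach-mulW (a ∷ as) u nu (ν>0 ∷ ν>0s) = Reach-trans (Reach-mulW as u nu ν>0s)
    (Reach-edge (lm-normal a (mulW as u) (mulW-normal as u nu))
                (λ moves → Q-arrival-pos _ a ν>0 (moves ∘ sym)))

  Reach-[] : ∀ n u → length u ≡ n → Normal u → Reach ν r λ' μ u []
  Reach-[] _       []      _   _  = here
  Reach-[] (suc n) (x ∷ w) len nu = Reach-trans
    (Reach-edge (dropLast-normal x w nu) λ _ → Q-service-pos x w)
    (Reach-[] n (dropLast (x ∷ w)) (trans (length-dropLast x w) (suc-injective len))
      (dropLast-normal x w nu))

mainTheorem1 : (P : PlainData) (ν : Letter P → ℚ) → PlainTriple P ν →
    (λ' μ : ℚ) → 0ℚ < λ' → 0ℚ < μ →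
    (r : Letter P → ℚ) → InB r →
    Irreducible ν r λ' μ
mainTheorem1 P ν triple λ' μ λ'>0 μ>0 r (r>0 , _) u v nu nv
  with PlainTriple.generates triple v nv
... | as , ν>0s , eval-as≡v =
  Reach-trans (Reach-[] (length u) u refl nu)
              (subst (Reach ν r λ' μ []) eval-as≡v (Reach-mulW as [] tt ν>0s))
  where
    open Queue ν r λ' μ (proj₁ (PlainTriple.prob triple)) r>0
               (infinite⇒nonemptyNext (PlainTriple.infinite triple)) λ'>0 μ>0
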